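{- For every odd prime number $p$, \[ \sum_{k=0}^{p-1}\frac{1}{4^{k}} \sum_{j=0}^k \binom{2j}{j}\binom{2k-2j}{k-j}(6j+1)(6k-6j+1) \equiv 0\pmod{p}. \]
   Context: For rational numbers $x,y$ whose denominators are coprime to $p$, $x\equiv y\pmod{p}$ means that $x-y$ equals $p$ times a rational number whose denominator is coprime to $p$. -}

module Defs where

open import Data.Nat using (ℕ; zero; suc; _∸_; _^_) renaming (_+_ to _+ℕ_; _*_ to _*ℕ_)
open import Data.Nat.Properties using (m^n≢0)
open import Data.Nat.Combinatorics using (_C_)
open import Data.Nat.Coprimality using (Coprime)
open import Data.Integer using (+_)
open import Data.Rational using (ℚ; _/_; _+_; _-_; _*_; 0ℚ)
open import Data.Product using (∃-syntax; _×_)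
open import Relation.Binary.PropositionalEquality using (_≡_)

sumℕ≤ : ℕ → (ℕ → ℕ) → ℕ
sumℕ≤ zero f = f 0
sumℕ≤ (suc n) f = sumℕ≤ n f +ℕ f (suc n)

sumℚ< : ℕ → (ℕ → ℚ) → ℚ
sumℚ< zero f = 0ℚ
sumℚ< (suc n) f = sumℚ< n f + f n

inner : ℕ → ℕ
inner k = sumℕ≤ k (λ j → ((2 *ℕ j) C j) *ℕ ((2 *ℕ k ∸ 2 *ℕ j) C (k ∸ j))
                         *ℕ (6 *ℕ j +ℕ 1) *ℕ (6 *ℕ k ∸ 6 *ℕ j +ℕ 1))

term : ℕ → ℚ
term k = _/_ (+ inner k) (4 ^ k) {{m^n≢0 4 k}}

_≡_[modℚ_] : ℚ → ℚ → ℕ → Set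
x ≡ y [modℚ p ] = ∃[ q ] (Coprime (ℚ.denominatorℕ q) p × x - y ≡ ((+ p) / 1) * q)

-- Write c_j = C(2j,j), so that (j+1) c_{j+1} = (4j+2) c_j. Pairing j with k-j gives
-- Σ_j j c_j c_{k-j} = (k/2) Σ_j c_j c_{k-j}, and the recurrence then yields, by induction on k,
-- Σ_j c_j c_{k-j} = 4^k and Σ_j j(k-j) c_j c_{k-j} = 4^k k(k-1)/8. Since
-- (6j+1)(6(k-j)+1) = (6k+1) + 36 j(k-j), the k-th term of the outer sum is the integer
-- 1 + 3k(3k+1)/2, and the whole sum equals p (1 + 3p(p-1)/2) exactly. Hence the congruence
-- holds for every p.

module Submission where

open import Defs
open import Data.Nat using (ℕ; zero; suc; pred; _+_; _*_; _∸_; _^_; _≤_; z≤n; NonZero)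
open import Data.Nat.Properties
  using ( *-zeroʳ; *-identityˡ; *-identityʳ; *-distribˡ-+; *-distribʳ-+; *-distribˡ-∸; *-comm; +-comm
        ; +-assoc; *-assoc; +-identityʳ; *-cancelˡ-≡; +-cancelʳ-≡; ≤-refl; m≤n⇒m≤1+n; m≤m+n; m+n∸m≡n
        ; m+[n∸m]≡n; m∸[m∸n]≡n; +-∸-assoc; n∸n≡0; m^n≢0)
open import Data.Nat.Combinatorics using (_C_; nC1≡n; nCk≡nC[n∸k]; nCk+nC[k+1]≡[n+1]C[k+1])
open import Data.Nat.Tactic.RingSolver using (solve-∀)
open import Data.Nat.Primality using (Prime)
open import Data.Nat.Coprimality using (1-coprimeTo) renaming (sym to coprime-sym)
import Data.Integer as ℤ
import Data.Integer.Properties as ℤₚ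
open import Data.Rational using (ℚ; mkℚ; 0ℚ; _/_)
import Data.Rational as ℚ
import Data.Rational.Properties as ℚ
open import Data.Rational.Unnormalised using (mkℚᵘ; *≡*)
open import Data.Product using (_,_)
open import Function using (_∘_)
open import Relation.Binary.PropositionalEquality
open ≡-Reasoning

absorption : ∀ n k → suc k * (suc n C suc k) ≡ suc n * (n C k)
absorption zero    zero    = refl
absorption zero    (suc k) = *-zeroʳ (suc (suc k))
absorption (suc n) zero    = begin
  1 * (suc (suc n) C 1) ≡⟨ *-identityˡ _ ⟩
  suc (suc n) C 1       ≡⟨ nC1≡n (suc (suc n)) ⟩
  suc (suc n)           ≡⟨ *-identityʳ _ ⟨
  suc (suc n) * 1       ∎
absorption (suc n) (suc k) = begin
  suc (suc k) * (suc (suc n) C suc (suc k))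
    ≡⟨ cong (suc (suc k) *_) (nCk+nC[k+1]≡[n+1]C[k+1] (suc n) (suc k)) ⟨
  suc (suc k) * (a + b)               ≡⟨ split k a b ⟩
  suc k * a + a + suc (suc k) * b     ≡⟨ cong₂ (λ x y → x + a + y) (absorption n k) (absorption n (suc k)) ⟩
  suc n * (n C k) + a + suc n * (n C suc k) ≡⟨ merge n (n C k) (n C suc k) a ⟩
  suc n * (n C k + n C suc k) + a     ≡⟨ cong (λ x → suc n * x + a) (nCk+nC[k+1]≡[n+1]C[k+1] n k) ⟩
  suc n * a + a                       ≡⟨ +-comm (suc n * a) a ⟩
  suc (suc n) * a                     ∎
  where
  a = suc n C suc k
  b = suc n C suc (suc k)
  split : ∀ k a b → suc (suc k) * (a + b) ≡ suc k * a + a + suc (suc k) * b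
  split = solve-∀
  merge : ∀ n x y a → suc n * x + a + suc n * y ≡ suc n * (x + y) + a
  merge = solve-∀

central : ℕ → ℕ
central n = (2 * n) C n

central-suc : ∀ k → suc k * central (suc k) ≡ (4 * k + 2) * central k
central-suc k = begin
  suc k * central (suc k)                 ≡⟨ cong (λ n → suc k * (n C suc k)) (2*suc k) ⟩
  suc k * (suc (suc (2 * k)) C suc k)     ≡⟨ absorption (suc (2 * k)) k ⟩
  suc (suc (2 * k)) * (suc (2 * k) C k)   ≡⟨ cong (suc (suc (2 * k)) *_) middle-symmetric ⟩
  suc (suc (2 * k)) * (suc (2 * k) C suc k) ≡⟨ double k (suc (2 * k) C suc k) ⟩
  2 * (suc k * (suc (2 * k) C suc k))     ≡⟨ cong (2 *_) (absorption (2 * k) k) ⟩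
  2 * (suc (2 * k) * central k)           ≡⟨ unfold k (central k) ⟩
  (4 * k + 2) * central k                 ∎
  where
  2*suc : ∀ k → 2 * suc k ≡ suc (suc (2 * k))
  2*suc = solve-∀
  double : ∀ k x → suc (suc (2 * k)) * x ≡ 2 * (suc k * x)
  double = solve-∀
  unfold : ∀ k x → 2 * (suc (2 * k) * x) ≡ (4 * k + 2) * x
  unfold = solve-∀
  k+suc[k] : ∀ k → k + suc k ≡ suc (2 * k)
  k+suc[k] = solve-∀
  middle-symmetric : suc (2 * k) C k ≡ suc (2 * k) C suc k
  middle-symmetric = begin
    suc (2 * k) C k             ≡⟨ nCk≡nC[n∸k] (subst (k ≤_) (k+suc[k] k) (m≤m+n k (suc k))) ⟩
    suc (2 * k) C (suc (2 * k) ∸ k) ≡⟨ cong (λ n → suc (2 * k) C (n ∸ k)) (k+suc[k] k) ⟨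
    suc (2 * k) C (k + suc k ∸ k)   ≡⟨ cong (suc (2 * k) C_) (m+n∸m≡n k (suc k)) ⟩
    suc (2 * k) C suc k         ∎

sumℕ≤-cong : ∀ n {f g : ℕ → ℕ} → (∀ {j} → j ≤ n → f j ≡ g j) → sumℕ≤ n f ≡ sumℕ≤ n g
sumℕ≤-cong zero    f≗g = f≗g z≤n
sumℕ≤-cong (suc n) f≗g = cong₂ _+_ (sumℕ≤-cong n (f≗g ∘ m≤n⇒m≤1+n)) (f≗g ≤-refl)

sumℕ≤-+ : ∀ n (f g : ℕ → ℕ) → sumℕ≤ n (λ j → f j + g j) ≡ sumℕ≤ n f + sumℕ≤ n g
sumℕ≤-+ zero    f g = refl
sumℕ≤-+ (suc n) f g = begin
  sumℕ≤ n (λ j → f j + g j) + (f (suc n) + g (suc n))   ≡⟨ cong (_+ (f (suc n) + g (suc n))) (sumℕ≤-+ n f g) ⟩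
  sumℕ≤ n f + sumℕ≤ n g + (f (suc n) + g (suc n))       ≡⟨ interchange (sumℕ≤ n f) (sumℕ≤ n g) (f (suc n)) (g (suc n)) ⟩
  sumℕ≤ n f + f (suc n) + (sumℕ≤ n g + g (suc n))       ∎
  where
  interchange : ∀ a b c d → a + b + (c + d) ≡ a + c + (b + d)
  interchange = solve-∀

sumℕ≤-*ˡ : ∀ n a (f : ℕ → ℕ) → sumℕ≤ n (λ j → a * f j) ≡ a * sumℕ≤ n f
sumℕ≤-*ˡ zero    a f = refl
sumℕ≤-*ˡ (suc n) a f = trans (cong (_+ a * f (suc n)) (sumℕ≤-*ˡ n a f)) (sym (*-distribˡ-+ a _ _))

sumℕ≤-linear : ∀ n a b (f g : ℕ → ℕ) →
  sumℕ≤ n (λ j → a * f j + b * g j) ≡ a * sumℕ≤ n f + b * sumℕ≤ n g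
sumℕ≤-linear n a b f g = trans (sumℕ≤-+ n _ _) (cong₂ _+_ (sumℕ≤-*ˡ n a f) (sumℕ≤-*ˡ n b g))

sumℕ≤-suc : ∀ n (f : ℕ → ℕ) → sumℕ≤ (suc n) f ≡ f 0 + sumℕ≤ n (λ j → f (suc j))
sumℕ≤-suc zero    f = refl
sumℕ≤-suc (suc n) f = trans (cong (_+ f (suc (suc n))) (sumℕ≤-suc n f)) (+-assoc (f 0) _ _)

sumℕ≤-reverse : ∀ n (f : ℕ → ℕ) → sumℕ≤ n f ≡ sumℕ≤ n (λ j → f (n ∸ j))
sumℕ≤-reverse zero    f = refl
sumℕ≤-reverse (suc n) f = begin
  sumℕ≤ n f + f (suc n)                 ≡⟨ cong (_+ f (suc n)) (sumℕ≤-reverse n f) ⟩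
  sumℕ≤ n (λ j → f (n ∸ j)) + f (suc n) ≡⟨ +-comm _ (f (suc n)) ⟩
  f (suc n) + sumℕ≤ n (λ j → f (n ∸ j)) ≡⟨ sumℕ≤-suc n (λ j → f (suc n ∸ j)) ⟨
  sumℕ≤ (suc n) (λ j → f (suc n ∸ j))   ∎

weight : ℕ → ℕ → ℕ
weight k j = central j * central (k ∸ j)

Σw Σjw Σj[k∸j]w : ℕ → ℕ
Σw       k = sumℕ≤ k (weight k)
Σjw      k = sumℕ≤ k (λ j → j * weight k j)
Σj[k∸j]w k = sumℕ≤ k (λ j → j * (k ∸ j) * weight k j)

2*Σjw≡k*Σw : ∀ k → 2 * Σjw k ≡ k * Σw k
2*Σjw≡k*Σw k = begin
  2 * Σjw k                                    ≡⟨ 2*x≡x+x (Σjw k) ⟩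
  Σjw k + Σjw k                                ≡⟨ cong (Σjw k +_) (trans (sumℕ≤-reverse k _) (sumℕ≤-cong k reflect)) ⟩
  Σjw k + sumℕ≤ k (λ j → (k ∸ j) * weight k j) ≡⟨ sumℕ≤-+ k _ _ ⟨
  sumℕ≤ k (λ j → j * weight k j + (k ∸ j) * weight k j) ≡⟨ sumℕ≤-cong k collect ⟩
  sumℕ≤ k (λ j → k * weight k j)               ≡⟨ sumℕ≤-*ˡ k k (weight k) ⟩
  k * Σw k                                     ∎
  where
  2*x≡x+x : ∀ x → 2 * x ≡ x + x
  2*x≡x+x = solve-∀
  reflect : ∀ {j} → j ≤ k → (k ∸ j) * weight k (k ∸ j) ≡ (k ∸ j) * weight k j
  reflect {j} j≤k = cong ((k ∸ j) *_) (begin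
    central (k ∸ j) * central (k ∸ (k ∸ j)) ≡⟨ cong (λ i → central (k ∸ j) * central i) (m∸[m∸n]≡n j≤k) ⟩
    central (k ∸ j) * central j             ≡⟨ *-comm (central (k ∸ j)) (central j) ⟩
    weight k j                              ∎)
  collect : ∀ {j} → j ≤ k → j * weight k j + (k ∸ j) * weight k j ≡ k * weight k j
  collect {j} j≤k = trans (sym (*-distribʳ-+ (weight k j) j (k ∸ j))) (cong (_* weight k j) (m+[n∸m]≡n j≤k))

Σjw-suc : ∀ k → Σjw (suc k) ≡ 4 * Σjw k + 2 * Σw k
Σjw-suc k = begin
  Σjw (suc k)                                      ≡⟨ sumℕ≤-suc k _ ⟩
  sumℕ≤ k (λ j → suc j * weight (suc k) (suc j))   ≡⟨ sumℕ≤-cong k (λ {j} _ → shift j) ⟩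
  sumℕ≤ k (λ j → 4 * (j * weight k j) + 2 * weight k j) ≡⟨ sumℕ≤-linear k 4 2 _ _ ⟩
  4 * Σjw k + 2 * Σw k                             ∎
  where
  expand : ∀ j x y → (4 * j + 2) * x * y ≡ 4 * (j * (x * y)) + 2 * (x * y)
  expand = solve-∀
  shift : ∀ j → suc j * weight (suc k) (suc j) ≡ 4 * (j * weight k j) + 2 * weight k j
  shift j = begin
    suc j * (central (suc j) * central (k ∸ j)) ≡⟨ *-assoc (suc j) (central (suc j)) (central (k ∸ j)) ⟨
    suc j * central (suc j) * central (k ∸ j)   ≡⟨ cong (_* central (k ∸ j)) (central-suc j) ⟩
    (4 * j + 2) * central j * central (k ∸ j)   ≡⟨ expand j (central j) (central (k ∸ j)) ⟩
    4 * (j * weight k j) + 2 * weight k j       ∎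

Σw≡4^k : ∀ k → Σw k ≡ 4 ^ k
Σw≡4^k zero    = refl
Σw≡4^k (suc k) = trans Σw-suc (cong (4 *_) (Σw≡4^k k))
  where
  regroup : ∀ v s → 2 * (4 * v + 2 * s) ≡ 4 * (2 * v) + 4 * s
  regroup = solve-∀
  factor : ∀ k s → 4 * (k * s) + 4 * s ≡ suc k * (4 * s)
  factor = solve-∀
  Σw-suc : Σw (suc k) ≡ 4 * Σw k
  Σw-suc = *-cancelˡ-≡ _ _ (suc k) (begin
    suc k * Σw (suc k)             ≡⟨ 2*Σjw≡k*Σw (suc k) ⟨
    2 * Σjw (suc k)                ≡⟨ cong (2 *_) (Σjw-suc k) ⟩
    2 * (4 * Σjw k + 2 * Σw k)     ≡⟨ regroup (Σjw k) (Σw k) ⟩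
    4 * (2 * Σjw k) + 4 * Σw k     ≡⟨ cong (λ x → 4 * x + 4 * Σw k) (2*Σjw≡k*Σw k) ⟩
    4 * (k * Σw k) + 4 * Σw k      ≡⟨ factor k (Σw k) ⟩
    suc k * (4 * Σw k)             ∎)

Σj[k∸j]w-suc-suc : ∀ m → Σj[k∸j]w (suc (suc m)) ≡ 16 * Σj[k∸j]w m + (8 * m + 4) * Σw m
Σj[k∸j]w-suc-suc m = begin
  Σj[k∸j]w (suc (suc m))            ≡⟨ sumℕ≤-suc (suc m) _ ⟩
  sumℕ≤ m g + g (suc m)             ≡⟨ cong (sumℕ≤ m g +_) g[1+m]≡0 ⟩
  sumℕ≤ m g + 0                     ≡⟨ +-identityʳ _ ⟩
  sumℕ≤ m g                         ≡⟨ sumℕ≤-cong m g≡ ⟩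
  sumℕ≤ m (λ j → 16 * (j * (m ∸ j) * weight m j) + (8 * m + 4) * weight m j)
                                    ≡⟨ sumℕ≤-linear m 16 (8 * m + 4) _ _ ⟩
  16 * Σj[k∸j]w m + (8 * m + 4) * Σw m ∎
  where
  g : ℕ → ℕ
  g j = suc j * (suc m ∸ j) * weight (suc (suc m)) (suc j)
  g[1+m]≡0 : g (suc m) ≡ 0
  g[1+m]≡0 = trans (cong (λ i → suc (suc m) * i * weight (suc (suc m)) (suc (suc m))) (n∸n≡0 m))
                   (cong (_* weight (suc (suc m)) (suc (suc m))) (*-zeroʳ (suc (suc m))))
  regroup : ∀ a b x y → suc a * suc b * (x * y) ≡ (suc a * x) * (suc b * y)
  regroup = solve-∀
  expand : ∀ a b x y → (4 * a + 2) * x * ((4 * b + 2) * y) ≡ 16 * (a * b * (x * y)) + (8 * (a + b) + 4) * (x * y)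
  expand = solve-∀
  g≡ : ∀ {j} → j ≤ m → g j ≡ 16 * (j * (m ∸ j) * weight m j) + (8 * m + 4) * weight m j
  g≡ {j} j≤m = begin
    g j                   ≡⟨ cong (λ i → suc j * i * (central (suc j) * central i)) (+-∸-assoc 1 j≤m) ⟩
    suc j * suc i * (central (suc j) * central (suc i))   ≡⟨ regroup j i (central (suc j)) (central (suc i)) ⟩
    (suc j * central (suc j)) * (suc i * central (suc i)) ≡⟨ cong₂ _*_ (central-suc j) (central-suc i) ⟩
    (4 * j + 2) * central j * ((4 * i + 2) * central i)  ≡⟨ expand j i (central j) (central i) ⟩
    16 * (j * i * weight m j) + (8 * (j + i) + 4) * weight m j
                          ≡⟨ cong (λ n → 16 * (j * i * weight m j) + (8 * n + 4) * weight m j) (m+[n∸m]≡n j≤m) ⟩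
    16 * (j * i * weight m j) + (8 * m + 4) * weight m j ∎
    where i = m ∸ j

-- The closed form 4^k k(k-1)/8, stated without subtraction or division.
8*Σj[k∸j]w+4^k*k≡4^k*k*k : ∀ k → 8 * Σj[k∸j]w k + 4 ^ k * k ≡ 4 ^ k * k * k
8*Σj[k∸j]w+4^k*k≡4^k*k*k zero          = refl
8*Σj[k∸j]w+4^k*k≡4^k*k*k (suc zero)    = refl
8*Σj[k∸j]w+4^k*k≡4^k*k*k (suc (suc m)) = +-cancelʳ-≡ (16 * (q * m)) _ _ (begin
  8 * Σj[k∸j]w (suc (suc m)) + 4 * (4 * q) * suc (suc m) + 16 * (q * m)
    ≡⟨ cong (λ u → 8 * u + 4 * (4 * q) * suc (suc m) + 16 * (q * m)) (Σj[k∸j]w-suc-suc m) ⟩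
  8 * (16 * Σj[k∸j]w m + (8 * m + 4) * Σw m) + 4 * (4 * q) * suc (suc m) + 16 * (q * m)
    ≡⟨ cong (λ s → 8 * (16 * Σj[k∸j]w m + (8 * m + 4) * s) + 4 * (4 * q) * suc (suc m) + 16 * (q * m)) (Σw≡4^k m) ⟩
  8 * (16 * Σj[k∸j]w m + (8 * m + 4) * q) + 4 * (4 * q) * suc (suc m) + 16 * (q * m)
    ≡⟨ regroup (Σj[k∸j]w m) q m ⟩
  16 * (8 * Σj[k∸j]w m + q * m) + 16 * q * (5 * m + 4)
    ≡⟨ cong (λ x → 16 * x + 16 * q * (5 * m + 4)) (8*Σj[k∸j]w+4^k*k≡4^k*k*k m) ⟩
  16 * (q * m * m) + 16 * q * (5 * m + 4)
    ≡⟨ finish q m ⟩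
  4 * (4 * q) * suc (suc m) * suc (suc m) + 16 * (q * m) ∎)
  where
  q = 4 ^ m
  regroup : ∀ u q m → 8 * (16 * u + (8 * m + 4) * q) + 4 * (4 * q) * suc (suc m) + 16 * (q * m)
                    ≡ 16 * (8 * u + q * m) + 16 * q * (5 * m + 4)
  regroup = solve-∀
  finish : ∀ q m → 16 * (q * m * m) + 16 * q * (5 * m + 4) ≡ 4 * (4 * q) * suc (suc m) * suc (suc m) + 16 * (q * m)
  finish = solve-∀

inner≡Σw+Σj[k∸j]w : ∀ k → inner k ≡ (6 * k + 1) * Σw k + 36 * Σj[k∸j]w k
inner≡Σw+Σj[k∸j]w k = trans (sumℕ≤-cong k summand≡) (sumℕ≤-linear k (6 * k + 1) 36 _ _)
  where
  expand : ∀ a b x y → x * y * (6 * a + 1) * (6 * b + 1)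
                     ≡ (6 * (a + b) + 1) * (x * y) + 36 * (a * b * (x * y))
  expand = solve-∀
  summand≡ : ∀ {j} → j ≤ k →
    ((2 * j) C j) * ((2 * k ∸ 2 * j) C (k ∸ j)) * (6 * j + 1) * (6 * k ∸ 6 * j + 1)
      ≡ (6 * k + 1) * weight k j + 36 * (j * (k ∸ j) * weight k j)
  summand≡ {j} j≤k = begin
    ((2 * j) C j) * ((2 * k ∸ 2 * j) C (k ∸ j)) * (6 * j + 1) * (6 * k ∸ 6 * j + 1)
      ≡⟨ cong₂ (λ a b → central j * (a C (k ∸ j)) * (6 * j + 1) * (b + 1))
               (*-distribˡ-∸ 2 k j) (*-distribˡ-∸ 6 k j) ⟨
    central j * central (k ∸ j) * (6 * j + 1) * (6 * (k ∸ j) + 1)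
      ≡⟨ expand j (k ∸ j) (central j) (central (k ∸ j)) ⟩
    (6 * (j + (k ∸ j)) + 1) * weight k j + 36 * (j * (k ∸ j) * weight k j)
      ≡⟨ cong (λ n → (6 * n + 1) * weight k j + 36 * (j * (k ∸ j) * weight k j)) (m+[n∸m]≡n j≤k) ⟩
    (6 * k + 1) * weight k j + 36 * (j * (k ∸ j) * weight k j) ∎

triangle : ℕ → ℕ
triangle zero    = 0
triangle (suc n) = triangle n + suc n

2*triangle : ∀ n → 2 * triangle n ≡ n * suc n
2*triangle zero    = refl
2*triangle (suc n) = begin
  2 * (triangle n + suc n)     ≡⟨ *-distribˡ-+ 2 (triangle n) (suc n) ⟩
  2 * triangle n + 2 * suc n   ≡⟨ cong (_+ 2 * suc n) (2*triangle n) ⟩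
  n * suc n + 2 * suc n        ≡⟨ factor n ⟩
  suc n * suc (suc n)          ∎
  where
  factor : ∀ n → n * suc n + 2 * suc n ≡ suc n * suc (suc n)
  factor = solve-∀

-- Proved after doubling and adding 9·4^k k to both sides, so that the subtraction-free closed
-- form for Σj[k∸j]w applies.
inner≡4^k*[1+triangle[3k]] : ∀ k → inner k ≡ 4 ^ k * suc (triangle (3 * k))
inner≡4^k*[1+triangle[3k]] k = *-cancelˡ-≡ _ _ 2 (+-cancelʳ-≡ (9 * (q * k)) _ _ (begin
  2 * inner k + 9 * (q * k)
    ≡⟨ cong (λ x → 2 * x + 9 * (q * k)) (inner≡Σw+Σj[k∸j]w k) ⟩
  2 * ((6 * k + 1) * Σw k + 36 * u) + 9 * (q * k)
    ≡⟨ cong (λ s → 2 * ((6 * k + 1) * s + 36 * u) + 9 * (q * k)) (Σw≡4^k k) ⟩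
  2 * ((6 * k + 1) * q + 36 * u) + 9 * (q * k)   ≡⟨ regroup k q u ⟩
  (12 * k + 2) * q + 9 * (8 * u + q * k)       ≡⟨ cong (λ x → (12 * k + 2) * q + 9 * x) (8*Σj[k∸j]w+4^k*k≡4^k*k*k k) ⟩
  (12 * k + 2) * q + 9 * (q * k * k)           ≡⟨ rearrange k q ⟩
  q * (2 + 3 * k * suc (3 * k)) + 9 * (q * k)   ≡⟨ cong (λ t → q * (2 + t) + 9 * (q * k)) (2*triangle (3 * k)) ⟨
  q * (2 + 2 * triangle (3 * k)) + 9 * (q * k)  ≡⟨ cong (_+ 9 * (q * k)) (halve q (triangle (3 * k))) ⟩
  2 * (q * suc (triangle (3 * k))) + 9 * (q * k) ∎))
  where
  q = 4 ^ k
  u = Σj[k∸j]w k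
  regroup : ∀ k q u → 2 * ((6 * k + 1) * q + 36 * u) + 9 * (q * k) ≡ (12 * k + 2) * q + 9 * (8 * u + q * k)
  regroup = solve-∀
  rearrange : ∀ k q → (12 * k + 2) * q + 9 * (q * k * k) ≡ q * (2 + 3 * k * suc (3 * k)) + 9 * (q * k)
  rearrange = solve-∀
  halve : ∀ q t → q * (2 + 2 * t) ≡ 2 * (q * suc t)
  halve = solve-∀

partialSum : ℕ → ℕ
partialSum n = n * suc (3 * triangle (pred n))

partialSum-suc : ∀ n → partialSum (suc n) ≡ partialSum n + suc (triangle (3 * n))
partialSum-suc zero    = refl
partialSum-suc (suc m) = *-cancelˡ-≡ _ _ 2 (begin
  2 * (suc (suc m) * suc (3 * (t + suc m)))           ≡⟨ expand m t ⟩
  suc (suc m) * (2 + 3 * (2 * t) + 6 * suc m)          ≡⟨ cong (λ x → suc (suc m) * (2 + 3 * x + 6 * suc m)) (2*triangle m) ⟩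
  suc (suc m) * (2 + 3 * (m * suc m) + 6 * suc m)      ≡⟨ polynomial m ⟩
  suc m * (2 + 3 * (m * suc m)) + (2 + 3 * suc m * suc (3 * suc m))
    ≡⟨ cong₂ (λ x y → suc m * (2 + 3 * x) + (2 + y)) (2*triangle m) (2*triangle (3 * suc m)) ⟨
  suc m * (2 + 3 * (2 * t)) + (2 + 2 * triangle (3 * suc m)) ≡⟨ collect m t (triangle (3 * suc m)) ⟩
  2 * (suc m * suc (3 * t) + suc (triangle (3 * suc m))) ∎)
  where
  t = triangle m
  expand : ∀ m t → 2 * (suc (suc m) * suc (3 * (t + suc m))) ≡ suc (suc m) * (2 + 3 * (2 * t) + 6 * suc m)
  expand = solve-∀
  polynomial : ∀ m → suc (suc m) * (2 + 3 * (m * suc m) + 6 * suc m)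
                   ≡ suc m * (2 + 3 * (m * suc m)) + (2 + 3 * suc m * suc (3 * suc m))
  polynomial = solve-∀
  collect : ∀ m t u → suc m * (2 + 3 * (2 * t)) + (2 + 2 * u) ≡ 2 * (suc m * suc (3 * t) + suc u)
  collect = solve-∀

ι : ℕ → ℚ
ι n = ℤ.+ n / 1

ι≡mkℚ : ∀ n → ι n ≡ mkℚ (ℤ.+ n) 0 (coprime-sym (1-coprimeTo n))
ι≡mkℚ n = ℚ.normalize-coprime (coprime-sym (1-coprimeTo n))

ι-+ : ∀ a b → ι a ℚ.+ ι b ≡ ι (a + b)
ι-+ a b = begin
  ι a ℚ.+ ι b                               ≡⟨ cong₂ ℚ._+_ (ι≡mkℚ a) (ι≡mkℚ b) ⟩
  (ℤ.+ a ℤ.* ℤ.+ 1 ℤ.+ ℤ.+ b ℤ.* ℤ.+ 1) / 1 ≡⟨ ℚ./-cong numerator refl ⟩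
  ι (a + b)                                 ∎
  where
  numerator : ℤ.+ a ℤ.* ℤ.+ 1 ℤ.+ ℤ.+ b ℤ.* ℤ.+ 1 ≡ ℤ.+ (a + b)
  numerator = trans (cong₂ ℤ._+_ (ℤₚ.*-identityʳ (ℤ.+ a)) (ℤₚ.*-identityʳ (ℤ.+ b))) (sym (ℤₚ.pos-+ a b))

ι-* : ∀ a b → ι a ℚ.* ι b ≡ ι (a * b)
ι-* a b = trans (cong₂ ℚ._*_ (ι≡mkℚ a) (ι≡mkℚ b)) (ℚ./-cong (sym (ℤₚ.pos-* a b)) refl)

/-≡ι : ∀ x d n .{{_ : NonZero d}} → x ≡ d * n → ℤ.+ x / d ≡ ι n
/-≡ι x (suc d) n x≡d*n = ℚ.fromℚᵘ-cong {mkℚᵘ (ℤ.+ x) d} {mkℚᵘ (ℤ.+ n) 0} (*≡* (begin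
  ℤ.+ x ℤ.* ℤ.+ 1     ≡⟨ ℤₚ.*-identityʳ (ℤ.+ x) ⟩
  ℤ.+ x               ≡⟨ cong ℤ.+_ (trans x≡d*n (*-comm (suc d) n)) ⟩
  ℤ.+ (n * suc d)     ≡⟨ ℤₚ.pos-* n (suc d) ⟩
  ℤ.+ n ℤ.* ℤ.+ suc d ∎))

term≡ι : ∀ k → term k ≡ ι (suc (triangle (3 * k)))
term≡ι k = /-≡ι (inner k) (4 ^ k) _ {{m^n≢0 4 k}} (inner≡4^k*[1+triangle[3k]] k)

sumℚ<-term : ∀ n → sumℚ< n term ≡ ι (partialSum n)
sumℚ<-term zero    = refl
sumℚ<-term (suc n) = begin
  sumℚ< n term ℚ.+ term n                        ≡⟨ cong₂ ℚ._+_ (sumℚ<-term n) (term≡ι n) ⟩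
  ι (partialSum n) ℚ.+ ι (suc (triangle (3 * n))) ≡⟨ ι-+ (partialSum n) (suc (triangle (3 * n))) ⟩
  ι (partialSum n + suc (triangle (3 * n)))       ≡⟨ cong ι (partialSum-suc n) ⟨
  ι (partialSum (suc n))                          ∎

corollary2 : (p : ℕ) → Prime p → p ≢ 2 →
    sumℚ< p term ≡ 0ℚ [modℚ p ]
corollary2 p _ _ = q , 1-coprimeTo p , (begin
  sumℚ< p term ℚ.- 0ℚ   ≡⟨ ℚ.+-identityʳ (sumℚ< p term) ⟩
  sumℚ< p term          ≡⟨ sumℚ<-term p ⟩
  ι (p * m)             ≡⟨ ι-* p m ⟨
  ι p ℚ.* ι m           ≡⟨ cong (ι p ℚ.*_) (ι≡mkℚ m) ⟩
  ι p ℚ.* q             ∎)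
  where
  m = suc (3 * triangle (pred p))
  q = mkℚ (ℤ.+ m) 0 (coprime-sym (1-coprimeTo m))
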